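{- Let $\mathcal{B}$ be a connected set of pieces with concurrence relation $\mathcal{R}$, and let $\beta_1,\beta_2\in\mathcal{B}$ be two distinct concurrent pieces. Then $$|\mathbb{P}^{\beta_2}(\mathcal{B})|=\sum_{\substack{\{\mathcal{B}_1,\mathcal{B}_2\}:\ \mathcal{B}_1\sqcup\mathcal{B}_2=\mathcal{B}\\ \beta_i\in\mathcal{B}_i,\ \mathcal{B}_i\text{ connected}}}|\mathbb{P}^{\beta_1}(\mathcal{B}_1)|\cdot|\mathbb{P}^{\beta_2}(\mathcal{B}_2)|.$$
   Context: A set of pieces is a finite set $\mathcal{B}$ with a reflexive symmetric relation $\mathcal{R}$ (concurrence). A subset $A\subseteq\mathcal{B}$ is connected if the graph on $A$ with edges $\{u,v\}$ for distinct concurrent $u,v\in A$ is connected. For $A\subseteq\mathcal{B}$, a full heap on $A$ is a partial order $\le$ on $A$ such that (i) if $x\mathcal{R}y$ then $x\le y$ or $y\le x$, and (ii) if $y$ covers $x$ then $x\mathcal{R}y$. A full pyramid is a full heap with a unique maximal element; $\mathbb{P}^{\beta}(A)$ is the set of full pyramids on $A$ (with $\mathcal{R}$ restricted to $A$) whose maximal element is $\beta$. -}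

module Defs where

open import Data.Bool using (Bool; true; false)
open import Data.Nat using (ℕ; zero; suc; _+_; _*_)
open import Data.Fin using (Fin; _≟_)
open import Data.Fin.Properties using (all?; any?)
open import Data.Fin.Subset using (Subset; _∈_; _∉_; ∁)
open import Data.Fin.Subset.Properties using (_∈?_)
open import Data.Vec using (Vec; []; _∷_; lookup)
open import Data.List using (List; []; _∷_; _++_; map; concatMap; length; filter)
open import Data.Nat.ListAction using (sum)
open import Data.Product using (_×_; ∃; _,_)
open import Data.Sum using (_⊎_)
open import Relation.Nullary using (¬_; Dec; yes; no; ¬?)
open import Relation.Nullary.Decidable using (_×-dec_; _⊎-dec_; _→-dec_)
open import Relation.Binary.PropositionalEquality using (_≡_; _≢_)
import Data.Bool.Properties as BoolP

allVecsOf : ∀ {a} {A : Set a} → List A → (m : ℕ) → List (Vec A m)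
allVecsOf xs zero    = [] ∷ []
allVecsOf xs (suc m) = concatMap (λ x → map (x ∷_) (allVecsOf xs m)) xs

allSubsets : (n : ℕ) → List (Subset n)
allSubsets n = allVecsOf (true ∷ false ∷ []) n

BRel : ℕ → Set
BRel n = Vec (Vec Bool n) n

allBRels : (n : ℕ) → List (BRel n)
allBRels n = allVecsOf (allSubsets n) n

count : ∀ {a p} {A : Set a} {P : A → Set p} → ((x : A) → Dec (P x)) → List A → ℕ
count P? xs = length (filter P? xs)

module Pieces {n : ℕ} (R : Fin n → Fin n → Bool) where

  _𝓡_ : Fin n → Fin n → Set
  x 𝓡 y = R x y ≡ true

  _𝓡?_ : (x y : Fin n) → Dec (x 𝓡 y)
  x 𝓡? y = R x y BoolP.≟ true

  Edge : Subset n → Fin n → Fin n → Set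
  Edge A u v = u ∈ A × v ∈ A × u ≢ v × u 𝓡 v

  WalkLe : Subset n → ℕ → Fin n → Fin n → Set
  WalkLe A zero    u v = u ≡ v
  WalkLe A (suc k) u v = WalkLe A k u v ⊎ ∃ λ w → WalkLe A k u w × Edge A w v

  -- connected: any two vertices of A are joined by a walk in A
  -- (a walk can always be shortened to one with fewer than n edges,
  --  so bounding the length by n loses nothing)
  Connected : Subset n → Set
  Connected A = ∀ u v → u ∈ A → v ∈ A → WalkLe A n u v

  -- Full heaps and full pyramids on A ⊆ B.
  -- A partial order on A is encoded as a relation on Fin n supported on A
  -- (so partial orders on A correspond bijectively to such relations).

  module _ (A : Subset n) (M : BRel n) where

    _≼_ : Fin n → Fin n → Set
    x ≼ y = lookup (lookup M x) y ≡ true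

    Covers : Fin n → Fin n → Set
    Covers x y = x ≼ y × x ≢ y ×
                 ¬ (∃ λ z → x ≼ z × x ≢ z × z ≼ y × z ≢ y)

    IsPartialOrderOn : Set
    IsPartialOrderOn =
      (∀ x y → x ≼ y → x ∈ A × y ∈ A) ×
      (∀ x → x ∈ A → x ≼ x) ×
      (∀ x y → x ≼ y → y ≼ x → x ≡ y) ×
      (∀ x y z → x ≼ y → y ≼ z → x ≼ z)

    IsFullHeap : Set
    IsFullHeap =
      IsPartialOrderOn ×
      (∀ x y → x ∈ A → y ∈ A → x 𝓡 y → x ≼ y ⊎ y ≼ x) ×
      (∀ x y → Covers x y → x 𝓡 y)

    Maximal : Fin n → Set
    Maximal m = m ∈ A × (∀ y → m ≼ y → y ≡ m)

    IsFullPyramid : Fin n → Set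
    IsFullPyramid β = IsFullHeap × Maximal β × (∀ m → Maximal m → m ≡ β)

  module _ (A : Subset n) (M : BRel n) where
    private
      le? : (x y : Fin n) → Dec (_≼_ A M x y)
      le? x y = lookup (lookup M x) y BoolP.≟ true

      ne? : (x y : Fin n) → Dec (x ≢ y)
      ne? x y = ¬? (x ≟ y)

      covers? : (x y : Fin n) → Dec (Covers A M x y)
      covers? x y = le? x y ×-dec ne? x y ×-dec
        ¬? (any? λ z → le? x z ×-dec ne? x z ×-dec le? z y ×-dec ne? z y)

      po? : Dec (IsPartialOrderOn A M)
      po? = all? (λ x → all? λ y → le? x y →-dec (x ∈? A ×-dec y ∈? A))
        ×-dec all? (λ x → x ∈? A →-dec le? x x)
        ×-dec all? (λ x → all? λ y → le? x y →-dec le? y x →-dec x ≟ y)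
        ×-dec all? (λ x → all? λ y → all? λ z →
                 le? x y →-dec le? y z →-dec le? x z)

      heap? : Dec (IsFullHeap A M)
      heap? = po?
        ×-dec all? (λ x → all? λ y → x ∈? A →-dec y ∈? A →-dec x 𝓡? y
                 →-dec (le? x y ⊎-dec le? y x))
        ×-dec all? (λ x → all? λ y → covers? x y →-dec x 𝓡? y)

      maximal? : (m : Fin n) → Dec (Maximal A M m)
      maximal? m = m ∈? A ×-dec all? (λ y → le? m y →-dec y ≟ m)

    isFullPyramid? : (β : Fin n) → Dec (IsFullPyramid A M β)
    isFullPyramid? β = heap? ×-dec maximal? β
      ×-dec all? (λ m → maximal? m →-dec m ≟ β)

  connected? : (A : Subset n) → Dec (Connected A)
  connected? A = all? λ u → all? λ v → u ∈? A →-dec v ∈? A →-dec walk? n u v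
    where
      edge? : (u v : Fin n) → Dec (Edge A u v)
      edge? u v = u ∈? A ×-dec v ∈? A ×-dec ¬? (u ≟ v) ×-dec u 𝓡? v
      walk? : (k : ℕ) (u v : Fin n) → Dec (WalkLe A k u v)
      walk? zero    u v = u ≟ v
      walk? (suc k) u v = walk? k u v ⊎-dec any? (λ w → walk? k u w ×-dec edge? w v)

  #P : Fin n → Subset n → ℕ
  #P β A = count (λ M → isFullPyramid? A M β) (allBRels n)

  -- Since β₁ ≠ β₂, each unordered partition {B₁,B₂}
  -- in the sum corresponds to exactly one such B₁.
  Admissible : Fin n → Fin n → Subset n → Set
  Admissible β₁ β₂ B₁ = β₁ ∈ B₁ × β₂ ∈ ∁ B₁ × Connected B₁ × Connected (∁ B₁)

  admissible? : (β₁ β₂ : Fin n) (B₁ : Subset n) → Dec (Admissible β₁ β₂ B₁)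
  admissible? β₁ β₂ B₁ = β₁ ∈? B₁ ×-dec β₂ ∈? ∁ B₁
    ×-dec connected? B₁ ×-dec connected? (∁ B₁)

  partitionSum : Fin n → Fin n → ℕ
  partitionSum β₁ β₂ =
    sum (map (λ B₁ → #P β₁ B₁ * #P β₂ (∁ B₁))
             (filter (admissible? β₁ β₂) (allSubsets n)))

module Submission where

-- A full pyramid M on B with top β₂ is cut along the down-set D of β₁.  Both
-- D and B ∖ D are order-convex, so M restricts to full pyramids on D (top β₁)
-- and on B ∖ D (top β₂); both are connected because every piece is joined to
-- the top by a chain of covers, and covers are concurrent.  Conversely, full
-- pyramids on B₁ ∋ β₁ and B₂ ∋ β₂ glue to a full pyramid on B with top β₂ by
-- putting x below y whenever x ≤ a, a R b and b ≤ y for some a ∈ B₁, b ∈ B₂.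
-- The two constructions are inverse because any x ≤ y with x ∈ D and y ∉ D
-- passes through a cover that crosses the cut.

open import Defs
open import Data.Bool using (Bool; true; false)
import Data.Bool.Properties as Bool
open import Data.Nat using (ℕ; zero; suc; _+_; _∸_; _*_; _≤_; _<_; z≤n; s≤s)
import Data.Nat.Properties as ℕ
open import Data.Nat.ListAction using (sum)
open import Data.Fin using (Fin; _≟_)
open import Data.Fin.Properties using (any?)
open import Data.Fin.Subset using (Subset; _∈_; _∉_; ∁; ⊤)
open import Data.Fin.Subset.Properties
  using (_∈?_; ∈⊤; ⊆-antisym; x∈p⇒x∉∁p; x∈∁p⇒x∉p; x∉p⇒x∈∁p)
open import Data.Vec using ([]; _∷_; lookup; tabulate)
open import Data.Vec.Properties
  using (∷-injective; lookup∘tabulate; tabulate∘lookup; tabulate-cong; []=⇒lookup; lookup⇒[]=)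
open import Data.List
  using (List; []; _∷_; _++_; map; concatMap; length; filter; allFin;
         cartesianProduct; cartesianProductWith)
open import Data.List.Properties
  using (filter-none; filter-≐; filter-++; filter-some; length-filter; length-++; length-map;
         length-tabulate; map-∘; map-id-local; map-cong)
open import Data.List.Membership.Propositional using (lose) renaming (_∈_ to _∈ₗ_)
open import Data.List.Membership.Propositional.Properties
  using (∈-map⁺; ∈-map⁻; ∈-filter⁺; ∈-filter⁻; ∈-allFin; ∈-cartesianProduct⁺; ∈-cartesianProductWith⁺)
open import Data.List.Membership.Propositional.Properties.WithK using (unique∧set⇒bag)
open import Data.List.Relation.Binary.BagAndSetEquality using (_∼[_]_; set; ∼bag⇒↭)
open import Data.List.Relation.Binary.Permutation.Propositional.Properties using (↭-length)
open import Data.List.Relation.Unary.All as All using (All; []; _∷_)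
open import Data.List.Relation.Unary.AllPairs using ([]; _∷_)
open import Data.List.Relation.Unary.Any using (here; there)
open import Data.List.Relation.Unary.Unique.Propositional using (Unique)
open import Data.List.Relation.Unary.Unique.Propositional.Properties
  using (filter⁺; map⁻; cartesianProduct⁺; cartesianProductWith⁺)
open import Data.Product using (_×_; ∃; ∃₂; _,_; proj₁; proj₂)
open import Data.Sum using (_⊎_; inj₁; inj₂)
import Data.Sum
open import Function.Base using (id; _∘_)
open import Function.Bundles using (mk⇔)
open import Relation.Nullary using (¬_; Dec; yes; no; ¬?; does; contradiction)
open import Relation.Nullary.Decidable using (_×-dec_; _⊎-dec_; dec-true)
open import Relation.Unary using (Decidable; _⊆_; _≐_)
open import Relation.Binary.PropositionalEquality

private
  variable
    A B : Set
    n : ℕ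

count-≐ : {P Q : A → Set} (P? : Decidable P) (Q? : Decidable Q) →
          P ≐ Q → ∀ xs → count P? xs ≡ count Q? xs
count-≐ P? Q? P≐Q xs = cong length (filter-≐ P? Q? P≐Q xs)

count-++ : {P : A → Set} (P? : Decidable P) → ∀ xs ys →
           count P? (xs ++ ys) ≡ count P? xs + count P? ys
count-++ P? xs ys = trans (cong length (filter-++ P? xs ys)) (length-++ (filter P? xs))

count-map : {P : B → Set} (P? : Decidable P) (f : A → B) → ∀ xs →
            count P? (map f xs) ≡ count (λ x → P? (f x)) xs
count-map P? f [] = refl
count-map P? f (x ∷ xs) with does (P? (f x))
... | true  = cong suc (count-map P? f xs)
... | false = count-map P? f xs

count-bijection : {P : A → Set} {Q : B → Set} (P? : Decidable P) (Q? : Decidable Q)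
  {xs : List A} {ys : List B} → Unique xs → Unique ys → (f : A → B) (g : B → A) →
  (∀ {x} → P x → f x ∈ₗ ys × Q (f x)) → (∀ {y} → Q y → g y ∈ₗ xs × P (g y)) →
  (∀ {x} → P x → g (f x) ≡ x) → (∀ {y} → Q y → f (g y) ≡ y) →
  count P? xs ≡ count Q? ys
-- The image under f of the P-part of xs is duplicate-free and has the same
-- members as the Q-part of ys, hence is a permutation of it.
count-bijection P? Q? {xs} {ys} xs! ys! f g f∈ g∈ gf≡ fg≡ = begin
  length xs′              ≡⟨ length-map f xs′ ⟨
  length (map f xs′)      ≡⟨ ↭-length (∼bag⇒↭ (unique∧set⇒bag fxs′! (filter⁺ Q? ys!) image)) ⟩
  length (filter Q? ys)   ∎
  where
    open ≡-Reasoning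
    xs′ = filter P? xs
    gfxs′ : map g (map f xs′) ≡ xs′
    gfxs′ = trans (sym (map-∘ xs′))
                  (map-id-local (All.tabulate λ m → gf≡ (proj₂ (∈-filter⁻ P? {xs = xs} m))))
    fxs′! : Unique (map f xs′)
    fxs′! = map⁻ (subst Unique (sym gfxs′) (filter⁺ P? xs!))
    image : map f xs′ ∼[ set ] filter Q? ys
    image = mk⇔ to from
      where
        to : ∀ {z} → z ∈ₗ map f xs′ → z ∈ₗ filter Q? ys
        to m with ∈-map⁻ f m
        ... | x , x∈ , refl = let (fx∈ , q) = f∈ (proj₂ (∈-filter⁻ P? {xs = xs} x∈)) in ∈-filter⁺ Q? fx∈ q
        from : ∀ {z} → z ∈ₗ filter Q? ys → z ∈ₗ map f xs′
        from m with ∈-filter⁻ Q? {xs = ys} m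
        ... | _ , q = let (gz∈ , p) = g∈ q in subst (_∈ₗ map f xs′) (fg≡ q) (∈-map⁺ f (∈-filter⁺ P? gz∈ p))

count-cartesianProduct : {D : A × B → Set} (D? : Decidable D) → ∀ xs ys →
  count D? (cartesianProduct xs ys) ≡ sum (map (λ x → count (λ y → D? (x , y)) ys) xs)
count-cartesianProduct D? []       ys = refl
count-cartesianProduct D? (x ∷ xs) ys = begin
  count D? (map (x ,_) ys ++ cartesianProduct xs ys)
    ≡⟨ count-++ D? (map (x ,_) ys) (cartesianProduct xs ys) ⟩
  count D? (map (x ,_) ys) + count D? (cartesianProduct xs ys)
    ≡⟨ cong₂ _+_ (count-map D? (x ,_) ys) (count-cartesianProduct D? xs ys) ⟩
  count (λ y → D? (x , y)) ys + sum (map (λ x → count (λ y → D? (x , y)) ys) xs) ∎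
  where open ≡-Reasoning

count-×-cartesianProduct : {P : A → Set} {Q : B → Set} (P? : Decidable P) (Q? : Decidable Q) →
  ∀ xs ys → count (λ xy → P? (proj₁ xy) ×-dec Q? (proj₂ xy)) (cartesianProduct xs ys)
            ≡ count P? xs * count Q? ys
count-×-cartesianProduct P? Q? xs ys =
  trans (count-cartesianProduct (λ xy → P? (proj₁ xy) ×-dec Q? (proj₂ xy)) xs ys) (go xs)
  where
    go : ∀ xs → sum (map (λ x → count (λ y → P? x ×-dec Q? y) ys) xs) ≡ count P? xs * count Q? ys
    go []       = refl
    go (x ∷ xs) with P? x
    ... | yes p = cong₂ _+_ (count-≐ _ Q? (proj₂ , (p ,_)) ys) (go xs)
    ... | no ¬p = cong₂ _+_ (cong length (filter-none _ (All.universal (λ _ → ¬p ∘ proj₁) ys))) (go xs)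

count-mono : {P Q : A → Set} (P? : Decidable P) (Q? : Decidable Q) →
          P ⊆ Q → ∀ xs → count P? xs ≤ count Q? xs
count-mono P? Q? P⊆Q [] = z≤n
count-mono P? Q? P⊆Q (x ∷ xs) with P? x | Q? x
... | yes p | yes _ = s≤s (count-mono P? Q? P⊆Q xs)
... | yes p | no ¬q = contradiction (P⊆Q p) ¬q
... | no _  | yes _ = ℕ.m≤n⇒m≤1+n (count-mono P? Q? P⊆Q xs)
... | no _  | no _  = count-mono P? Q? P⊆Q xs

count-< : {P Q : A → Set} (P? : Decidable P) (Q? : Decidable Q) → P ⊆ Q →
          ∀ {x} xs → x ∈ₗ xs → Q x → ¬ P x → count P? xs < count Q? xs
count-< P? Q? P⊆Q (y ∷ xs) (here refl) q ¬p with P? y | Q? y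
... | yes p | _     = contradiction p ¬p
... | no _  | yes _ = s≤s (count-mono P? Q? P⊆Q xs)
... | no _  | no ¬q = contradiction q ¬q
count-< P? Q? P⊆Q (y ∷ xs) (there x∈) q ¬p with P? y | Q? y
... | yes p | yes _ = s≤s (count-< P? Q? P⊆Q xs x∈ q ¬p)
... | yes p | no ¬q = contradiction (P⊆Q p) ¬q
... | no _  | yes _ = ℕ.m<n⇒m<1+n (count-< P? Q? P⊆Q xs x∈ q ¬p)
... | no _  | no _  = count-< P? Q? P⊆Q xs x∈ q ¬p

allVecsOf-suc : (xs : List A) (m : ℕ) →
                allVecsOf xs (suc m) ≡ cartesianProductWith _∷_ xs (allVecsOf xs m)
allVecsOf-suc xs m = go xs
  where
    go : ∀ ys → concatMap (λ y → map (y ∷_) (allVecsOf xs m)) ys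
                ≡ cartesianProductWith _∷_ ys (allVecsOf xs m)
    go []       = refl
    go (y ∷ ys) = cong (map (y ∷_) (allVecsOf xs m) ++_) (go ys)

allVecsOf-unique : {xs : List A} (m : ℕ) → Unique xs → Unique (allVecsOf xs m)
allVecsOf-unique zero    xs! = [] ∷ []
allVecsOf-unique {xs = xs} (suc m) xs! rewrite allVecsOf-suc xs m =
  cartesianProductWith⁺ _∷_ ∷-injective xs! (allVecsOf-unique m xs!)

∈-allVecsOf : {xs : List A} (m : ℕ) → (∀ x → x ∈ₗ xs) → ∀ v → v ∈ₗ allVecsOf xs m
∈-allVecsOf zero    ∈xs []      = here refl
∈-allVecsOf {xs = xs} (suc m) ∈xs (x ∷ v) rewrite allVecsOf-suc xs m =
  ∈-cartesianProductWith⁺ _∷_ (∈xs x) (∈-allVecsOf m ∈xs v)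

∈-bools : ∀ b → b ∈ₗ true ∷ false ∷ []
∈-bools true  = here refl
∈-bools false = there (here refl)

allSubsets-unique : ∀ n → Unique (allSubsets n)
allSubsets-unique n = allVecsOf-unique n (((λ ()) ∷ []) ∷ [] ∷ [])

∈-allSubsets : ∀ n p → p ∈ₗ allSubsets n
∈-allSubsets n = ∈-allVecsOf n ∈-bools

allBRels-unique : ∀ n → Unique (allBRels n)
allBRels-unique n = allVecsOf-unique n (allSubsets-unique n)

∈-allBRels : ∀ n M → M ∈ₗ allBRels n
∈-allBRels n = ∈-allVecsOf n (∈-allSubsets n)

does≡true⇒ : {P : Set} (P? : Dec P) → does P? ≡ true → P
does≡true⇒ (yes p) _ = p

subsetOf : {P : Fin n → Set} → (∀ x → Dec (P x)) → Subset n
subsetOf P? = tabulate λ x → does (P? x)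

∈-subsetOf⁺ : {P : Fin n → Set} (P? : ∀ x → Dec (P x)) {x : Fin n} → P x → x ∈ subsetOf P?
∈-subsetOf⁺ P? {x} p = lookup⇒[]= x (subsetOf P?) (trans (lookup∘tabulate _ x) (dec-true (P? x) p))

∈-subsetOf⁻ : {P : Fin n → Set} (P? : ∀ x → Dec (P x)) {x : Fin n} → x ∈ subsetOf P? → P x
∈-subsetOf⁻ P? {x} x∈ = does≡true⇒ (P? x) (trans (sym (lookup∘tabulate _ x)) ([]=⇒lookup x∈))

_≤[_]_ : Fin n → BRel n → Fin n → Set
x ≤[ M ] y = lookup (lookup M x) y ≡ true

_≤[_]?_ : (x : Fin n) (M : BRel n) (y : Fin n) → Dec (x ≤[ M ] y)
x ≤[ M ]? y = lookup (lookup M x) y Bool.≟ true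

fromDec : {D : Fin n → Fin n → Set} → (∀ x y → Dec (D x y)) → BRel n
fromDec D? = tabulate λ x → tabulate λ y → does (D? x y)

lookup-fromDec : {D : Fin n → Fin n → Set} (D? : ∀ x y → Dec (D x y)) (x y : Fin n) →
                 lookup (lookup (fromDec D?) x) y ≡ does (D? x y)
lookup-fromDec D? x y =
  trans (cong (λ row → lookup row y) (lookup∘tabulate _ x)) (lookup∘tabulate _ y)

fromDec⁺ : {D : Fin n → Fin n → Set} (D? : ∀ x y → Dec (D x y)) {x y : Fin n} →
           D x y → x ≤[ fromDec D? ] y
fromDec⁺ D? {x} {y} d = trans (lookup-fromDec D? x y) (dec-true (D? x y) d)

fromDec⁻ : {D : Fin n → Fin n → Set} (D? : ∀ x y → Dec (D x y)) {x y : Fin n} →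
           x ≤[ fromDec D? ] y → D x y
fromDec⁻ D? {x} {y} le = does≡true⇒ (D? x y) (trans (sym (lookup-fromDec D? x y)) le)

BRel-ext : {M M′ : BRel n} → (∀ {x y} → x ≤[ M ] y → x ≤[ M′ ] y) →
           (∀ {x y} → x ≤[ M′ ] y → x ≤[ M ] y) → M ≡ M′
BRel-ext {M = M} {M′} to from = begin
  M                                                        ≡⟨ tabulate∘lookup M ⟨
  tabulate (lookup M)                                      ≡⟨ tabulate-cong row ⟩
  tabulate (lookup M′)                                     ≡⟨ tabulate∘lookup M′ ⟩
  M′                                                       ∎
  where
    open ≡-Reasoning
    row : ∀ x → lookup M x ≡ lookup M′ x
    row x = trans (sym (tabulate∘lookup (lookup M x)))
                  (trans (tabulate-cong (λ y → Bool.⇔→≡ (mk⇔ to from)))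
                         (tabulate∘lookup (lookup M′ x)))

module Heaps {n : ℕ} (R : Fin n → Fin n → Bool) where
  open Pieces R

  module PartialOrderOn {A : Subset n} (M : BRel n) (po : IsPartialOrderOn A M) where

    support : ∀ {x y} → x ≤[ M ] y → x ∈ A × y ∈ A
    support {x} {y} = proj₁ po x y

    ≤-refl : ∀ {x} → x ∈ A → x ≤[ M ] x
    ≤-refl {x} = proj₁ (proj₂ po) x

    ≤-antisym : ∀ {x y} → x ≤[ M ] y → y ≤[ M ] x → x ≡ y
    ≤-antisym {x} {y} = proj₁ (proj₂ (proj₂ po)) x y

    ≤-trans : ∀ {x y z} → x ≤[ M ] y → y ≤[ M ] z → x ≤[ M ] z
    ≤-trans {x} {y} {z} = proj₂ (proj₂ (proj₂ po)) x y z

    StrictlyBetween : Fin n → Fin n → Fin n → Set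
    StrictlyBetween x w z = x ≤[ M ] w × x ≢ w × w ≤[ M ] z × w ≢ z

    intervalSize : Fin n → Fin n → ℕ
    intervalSize x z = count (λ t → x ≤[ M ]? t ×-dec t ≤[ M ]? z) (allFin n)

    intervalSize-<ˡ : ∀ {x w z} → x ≤[ M ] z → StrictlyBetween x w z → intervalSize x w < intervalSize x z
    intervalSize-<ˡ {x} {w} {z} x≤z (_ , _ , w≤z , w≢z) =
      count-< _ _ (λ (x≤t , t≤w) → x≤t , ≤-trans t≤w w≤z) (allFin n) (∈-allFin z)
              (x≤z , ≤-refl (proj₂ (support x≤z))) (λ (_ , z≤w) → w≢z (≤-antisym w≤z z≤w))

    intervalSize-<ʳ : ∀ {x w z} → x ≤[ M ] z → StrictlyBetween x w z → intervalSize w z < intervalSize x z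
    intervalSize-<ʳ {x} {w} {z} x≤z (x≤w , x≢w , _ , _) =
      count-< _ _ (λ (w≤t , t≤z) → ≤-trans x≤w w≤t , t≤z) (allFin n) (∈-allFin x)
              (≤-refl (proj₁ (support x≤z)) , x≤z) (λ (w≤x , _) → x≢w (≤-antisym x≤w w≤x))

    interval-induction : (Q : Fin n → Fin n → Set) → (∀ x → Q x x) →
      (∀ {x z} → Covers A M x z → Q x z) →
      (∀ {x w z} → x ≤[ M ] w → w ≤[ M ] z → Q x w → Q w z → Q x z) →
      ∀ {x z} → x ≤[ M ] z → Q x z
    interval-induction Q base cover compose {x} {z} x≤z = go (suc (intervalSize x z)) x≤z ℕ.≤-refl
      where
        go : ∀ fuel {x z} → x ≤[ M ] z → intervalSize x z < fuel → Q x z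
        go (suc fuel) {x} {z} x≤z size< with x ≟ z
        ... | yes refl = base x
        ... | no x≢z with any? (λ w → x ≤[ M ]? w ×-dec ¬? (x ≟ w) ×-dec w ≤[ M ]? z ×-dec ¬? (w ≟ z))
        ... | no nothing-between = cover (x≤z , x≢z , nothing-between)
        ... | yes (w , between@(x≤w , _ , w≤z , _)) =
          compose x≤w w≤z
            (go fuel x≤w (ℕ.<-≤-trans (intervalSize-<ˡ x≤z between) (ℕ.≤-pred size<)))
            (go fuel w≤z (ℕ.<-≤-trans (intervalSize-<ʳ x≤z between) (ℕ.≤-pred size<)))

    upsetSize : Fin n → ℕ
    upsetSize x = count (x ≤[ M ]?_) (allFin n)

    below-maximal : ∀ {x} → x ∈ A → ∃ λ m → Maximal A M m × x ≤[ M ] m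
    below-maximal {x} x∈A = go (suc (upsetSize x)) x∈A ℕ.≤-refl
      where
        go : ∀ fuel {x} → x ∈ A → upsetSize x < fuel → ∃ λ m → Maximal A M m × x ≤[ M ] m
        go (suc fuel) {x} x∈A size< with any? (λ y → x ≤[ M ]? y ×-dec ¬? (y ≟ x))
        ... | yes (y , x≤y , y≢x) =
          let (m , max , y≤m) = go fuel (proj₂ (support x≤y)) (ℕ.<-≤-trans upsetSize-< (ℕ.≤-pred size<))
          in m , max , ≤-trans x≤y y≤m
          where
            upsetSize-< : upsetSize y < upsetSize x
            upsetSize-< = count-< _ _ (≤-trans x≤y) (allFin n) (∈-allFin x) (≤-refl x∈A)
                                  (λ y≤x → y≢x (≤-antisym y≤x x≤y))
        ... | no nothing-above = x , (x∈A , above-is-x) , ≤-refl x∈A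
          where
            above-is-x : ∀ y → x ≤[ M ] y → y ≡ x
            above-is-x y x≤y with y ≟ x
            ... | yes y≡x = y≡x
            ... | no y≢x  = contradiction (y , x≤y , y≢x) nothing-above

  module FullHeap {A : Subset n} (M : BRel n) (h : IsFullHeap A M) where
    open PartialOrderOn M (proj₁ h) public

    comparable : ∀ {x y} → x ∈ A → y ∈ A → x 𝓡 y → x ≤[ M ] y ⊎ y ≤[ M ] x
    comparable {x} {y} = proj₁ (proj₂ h) x y

    cover⇒𝓡 : ∀ {x y} → Covers A M x y → x 𝓡 y
    cover⇒𝓡 {x} {y} = proj₂ (proj₂ h) x y

  below-top : ∀ {A} M {β} → IsFullPyramid A M β → ∀ {x} → x ∈ A → x ≤[ M ] β
  below-top M (heap , _ , unique-max) {x} x∈A =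
    let (m , max , x≤m) = PartialOrderOn.below-maximal M (proj₁ heap) x∈A
    in subst (x ≤[ M ]_) (unique-max m max) x≤m

  greatest⇒isFullPyramid : ∀ {A β} M → IsFullHeap A M → β ∈ A →
                           (∀ {x} → x ∈ A → x ≤[ M ] β) → IsFullPyramid A M β
  greatest⇒isFullPyramid M heap β∈A greatest =
    heap , (β∈A , λ y β≤y → ≤-antisym (greatest (proj₂ (support β≤y))) β≤y) ,
    λ m (m∈A , max) → sym (max _ (greatest m∈A))
    where open FullHeap M heap

  Convex : BRel n → Subset n → Set
  Convex M S = ∀ {x y z} → x ∈ S → z ∈ S → x ≤[ M ] y → y ≤[ M ] z → y ∈ S

  module _ (M : BRel n) (S : Subset n) where
    private
      restricted? : ∀ x y → Dec (x ≤[ M ] y × x ∈ S × y ∈ S)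
      restricted? x y = x ≤[ M ]? y ×-dec x ∈? S ×-dec y ∈? S

    restrict : BRel n
    restrict = fromDec restricted?

    restrict⁺ : ∀ {x y} → x ≤[ M ] y → x ∈ S → y ∈ S → x ≤[ restrict ] y
    restrict⁺ x≤y x∈S y∈S = fromDec⁺ restricted? (x≤y , x∈S , y∈S)

    restrict⁻ : ∀ {x y} → x ≤[ restrict ] y → x ≤[ M ] y × x ∈ S × y ∈ S
    restrict⁻ = fromDec⁻ restricted?

  restrict-isFullHeap : ∀ {A} M → IsFullHeap A M → ∀ {S} → (∀ {x} → x ∈ S → x ∈ A) →
                        Convex M S → IsFullHeap S (restrict M S)
  restrict-isFullHeap {A} M heap {S} S⊆A convex =
    ((λ _ _ x≤y → proj₂ (restrict⁻ M S x≤y)) ,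
     (λ _ x∈S → restrict⁺ M S (≤-refl (S⊆A x∈S)) x∈S x∈S) ,
     (λ _ _ x≤y y≤x → ≤-antisym (proj₁ (restrict⁻ M S x≤y)) (proj₁ (restrict⁻ M S y≤x))) ,
     (λ _ _ _ x≤y y≤z →
        let (x≤y , x∈S , _) = restrict⁻ M S x≤y ; (y≤z , _ , z∈S) = restrict⁻ M S y≤z
        in restrict⁺ M S (≤-trans x≤y y≤z) x∈S z∈S)) ,
    (λ _ _ x∈S y∈S x𝓡y → Data.Sum.map (λ x≤y → restrict⁺ M S x≤y x∈S y∈S)
                                      (λ y≤x → restrict⁺ M S y≤x y∈S x∈S)
                                      (comparable (S⊆A x∈S) (S⊆A y∈S) x𝓡y)) ,
    (λ _ _ cover → cover⇒𝓡 (covers-in-M cover))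
    where
      open FullHeap M heap
      covers-in-M : ∀ {x y} → Covers S (restrict M S) x y → Covers A M x y
      covers-in-M (x≤y , x≢y , nothing-between) =
        let (x≤y , x∈S , y∈S) = restrict⁻ M S x≤y
        in x≤y , x≢y , λ (z , x≤z , x≢z , z≤y , z≢y) →
             let z∈S = convex x∈S y∈S x≤z z≤y
             in nothing-between (z , restrict⁺ M S x≤z x∈S z∈S , x≢z , restrict⁺ M S z≤y z∈S y∈S , z≢y)

  restrict-isFullPyramid : ∀ {A} M → IsFullHeap A M → ∀ {S c} → (∀ {x} → x ∈ S → x ∈ A) →
    Convex M S → c ∈ S → (∀ {x} → x ∈ S → x ≤[ M ] c) → IsFullPyramid S (restrict M S) c
  restrict-isFullPyramid M heap {S} S⊆A convex c∈S greatest =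
    greatest⇒isFullPyramid (restrict M S) (restrict-isFullHeap M heap S⊆A convex) c∈S
      (λ x∈S → restrict⁺ M S (greatest x∈S) x∈S c∈S)

  -- Connectedness through chains of covers

  data Path (S : Subset n) : Fin n → Fin n → Set where
    []   : ∀ {u} → Path S u u
    _∷ʳ_ : ∀ {u w v} → Path S u w → Edge S w v → Path S u v

  _++ₚ_ : ∀ {S u w v} → Path S u w → Path S w v → Path S u v
  p ++ₚ []       = p
  p ++ₚ (q ∷ʳ e) = (p ++ₚ q) ∷ʳ e

  path⇒walk : ∀ {S u v} → Path S u v → ∃ λ k → WalkLe S k u v
  path⇒walk []       = 0 , refl
  path⇒walk (p ∷ʳ e) = let (k , walk) = path⇒walk p in suc k , inj₂ (_ , walk , e)

  convex-path : ∀ {A} M → IsFullHeap A M → ∀ {S} → Convex M S →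
                ∀ {x z} → x ≤[ M ] z → x ∈ S → z ∈ S → Path S x z
  convex-path M heap {S} convex =
    interval-induction (λ x z → x ∈ S → z ∈ S → Path S x z)
      (λ _ _ _ → [])
      (λ cover x∈S z∈S → [] ∷ʳ (x∈S , z∈S , proj₁ (proj₂ cover) , cover⇒𝓡 cover))
      (λ x≤w w≤z path-xw path-wz x∈S z∈S →
         let w∈S = convex x∈S z∈S x≤w w≤z in path-xw x∈S w∈S ++ₚ path-wz w∈S z∈S)
    where open FullHeap M heap

  -- The sets of pieces reachable from u in at most k steps grow strictly until
  -- they stabilise; having at most n elements, they are stable from step n on.
  module WalkShortening (S : Subset n) (u : Fin n) where

    Reach : ℕ → Fin n → Set
    Reach k v = WalkLe S k u v

    reach? : ∀ k v → Dec (Reach k v)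
    reach? zero    v = u ≟ v
    reach? (suc k) v = reach? k v ⊎-dec any? λ w → reach? k w ×-dec edge? w v
      where
        edge? : ∀ w v → Dec (Edge S w v)
        edge? w v = w ∈? S ×-dec v ∈? S ×-dec ¬? (w ≟ v) ×-dec w 𝓡? v

    reachCount : ℕ → ℕ
    reachCount k = count (reach? k) (allFin n)

    Stable : ℕ → Set
    Stable k = ∀ {v} → Reach (suc k) v → Reach k v

    reach-lift : ∀ j {k v} → Reach k v → Reach (j + k) v
    reach-lift zero    r = r
    reach-lift (suc j) r = inj₁ (reach-lift j r)

    stable-settles : ∀ {k} → Stable k → ∀ j {v} → Reach (j + k) v → Reach k v
    stable-settles stable zero    r                  = r
    stable-settles stable (suc j) (inj₁ r)           = stable-settles stable j r
    stable-settles stable (suc j) (inj₂ (w , r , e)) = stable (inj₂ (w , stable-settles stable j r , e))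

    stable-suc : ∀ {k} → Stable k → Stable (suc k)
    stable-suc stable r = inj₁ (stable-settles stable 2 r)

    growing-or-stable : ∀ k → suc k ≤ reachCount k ⊎ Stable k
    growing-or-stable zero = inj₁ (filter-some (reach? 0) (lose (∈-allFin u) refl))
    growing-or-stable (suc k) with growing-or-stable k
    ... | inj₂ stable = inj₂ (stable-suc stable)
    ... | inj₁ grown with any? (λ v → reach? (suc k) v ×-dec ¬? (reach? k v))
    ...   | yes (v , r , ¬r) =
      inj₁ (ℕ.≤-trans (s≤s grown) (count-< (reach? k) (reach? (suc k)) inj₁ (allFin n) (∈-allFin v) r ¬r))
    ...   | no nothing-new = inj₂ (stable-suc stable)
      where
        stable : Stable k
        stable {v} r with reach? k v
        ... | yes r′ = r′
        ... | no ¬r′ = contradiction (v , r , ¬r′) nothing-new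

    stable-at-n : Stable n
    stable-at-n with growing-or-stable n
    ... | inj₂ stable = stable
    ... | inj₁ grown  = contradiction (ℕ.≤-trans grown reachCount≤n) ℕ.1+n≰n
      where
        reachCount≤n : reachCount n ≤ n
        reachCount≤n = ℕ.≤-trans (length-filter (reach? n) (allFin n)) (ℕ.≤-reflexive (length-tabulate id))

    shorten : ∀ {k v} → Reach k v → Reach n v
    shorten {k} {v} r with k ℕ.≤? n
    ... | yes k≤n = subst (λ m → Reach m v) (ℕ.m∸n+n≡m k≤n) (reach-lift (n ∸ k) r)
    ... | no  k≰n = stable-settles stable-at-n (k ∸ n)
                      (subst (λ m → Reach m v) (sym (ℕ.m∸n+n≡m (ℕ.<⇒≤ (ℕ.≰⇒> k≰n)))) r)

  module _ (𝓡-sym : ∀ x y → x 𝓡 y → y 𝓡 x) where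

    reverseₚ : ∀ {S u v} → Path S u v → Path S v u
    reverseₚ []                            = []
    reverseₚ (p ∷ʳ (w∈S , v∈S , w≢v , w𝓡v)) =
      ([] ∷ʳ (v∈S , w∈S , w≢v ∘ sym , 𝓡-sym _ _ w𝓡v)) ++ₚ reverseₚ p

    paths-to-centre⇒connected : ∀ {S} c → (∀ {u} → u ∈ S → Path S u c) → Connected S
    paths-to-centre⇒connected c path-to-c u v u∈S v∈S =
      let (k , walk) = path⇒walk (path-to-c u∈S ++ₚ reverseₚ (path-to-c v∈S))
      in WalkShortening.shorten _ u walk

    convex-connected : ∀ {A} M → IsFullHeap A M → ∀ {S c} → Convex M S → c ∈ S →
                       (∀ {x} → x ∈ S → x ≤[ M ] c) → Connected S
    convex-connected M heap convex c∈S greatest =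
      paths-to-centre⇒connected _ λ u∈S → convex-path M heap convex (greatest u∈S) u∈S c∈S

  -- Gluing two full heaps along a cut

  covers-⊆ : ∀ {A} M M′ → (∀ {x y} → x ≤[ M′ ] y → x ≤[ M ] y) →
             ∀ {x y} → x ≤[ M′ ] y → Covers A M x y → Covers A M′ x y
  covers-⊆ M M′ M′⊆M x≤′y (_ , x≢y , nothing-between) =
    x≤′y , x≢y , λ (z , x≤z , x≢z , z≤y , z≢y) → nothing-between (z , M′⊆M x≤z , x≢z , M′⊆M z≤y , z≢y)

  module _ (M₁ M₂ : BRel n) where

    Bridge : Fin n → Fin n → Set
    Bridge x y = ∃₂ λ a b → x ≤[ M₁ ] a × a 𝓡 b × b ≤[ M₂ ] y

    Glued : Fin n → Fin n → Set
    Glued x y = x ≤[ M₁ ] y ⊎ x ≤[ M₂ ] y ⊎ Bridge x y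

    private
      glued? : ∀ x y → Dec (Glued x y)
      glued? x y = x ≤[ M₁ ]? y ⊎-dec x ≤[ M₂ ]? y ⊎-dec
                   any? λ a → any? λ b → x ≤[ M₁ ]? a ×-dec a 𝓡? b ×-dec b ≤[ M₂ ]? y

    glue : BRel n
    glue = fromDec glued?

    glue⁺ : ∀ {x y} → Glued x y → x ≤[ glue ] y
    glue⁺ = fromDec⁺ glued?

    glue⁻ : ∀ {x y} → x ≤[ glue ] y → Glued x y
    glue⁻ = fromDec⁻ glued?

  module GluedHeaps {B : Subset n} (M₁ M₂ : BRel n)
                    (heap₁ : IsFullHeap B M₁) (heap₂ : IsFullHeap (∁ B) M₂) where
    private
      module H₁ = FullHeap M₁ heap₁
      module H₂ = FullHeap M₂ heap₂

    bridge-source : ∀ {x y} → Bridge M₁ M₂ x y → x ∈ B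
    bridge-source (_ , _ , x≤a , _) = proj₁ (H₁.support x≤a)

    bridge-target : ∀ {x y} → Bridge M₁ M₂ x y → y ∈ ∁ B
    bridge-target (_ , _ , _ , _ , b≤y) = proj₂ (H₂.support b≤y)

    glued-into-B : ∀ {x y} → y ∈ B → Glued M₁ M₂ x y → x ≤[ M₁ ] y
    glued-into-B y∈B (inj₁ x≤y)         = x≤y
    glued-into-B y∈B (inj₂ (inj₁ x≤y))  = contradiction (proj₂ (H₂.support x≤y)) (x∈p⇒x∉∁p y∈B)
    glued-into-B y∈B (inj₂ (inj₂ bridge)) = contradiction (bridge-target bridge) (x∈p⇒x∉∁p y∈B)

    glued-out-of-∁B : ∀ {x y} → x ∈ ∁ B → Glued M₁ M₂ x y → x ≤[ M₂ ] y
    glued-out-of-∁B x∈∁B (inj₁ x≤y)          = contradiction (proj₁ (H₁.support x≤y)) (x∈∁p⇒x∉p x∈∁B)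
    glued-out-of-∁B x∈∁B (inj₂ (inj₁ x≤y))   = x≤y
    glued-out-of-∁B x∈∁B (inj₂ (inj₂ bridge)) = contradiction (bridge-source bridge) (x∈∁p⇒x∉p x∈∁B)

    glued-antisym : ∀ {x y} → Glued M₁ M₂ x y → Glued M₁ M₂ y x → x ≡ y
    glued-antisym {x} x≤y y≤x with x ∈? B
    ... | yes x∈B = let y≤₁x = glued-into-B x∈B y≤x
                    in H₁.≤-antisym (glued-into-B (proj₁ (H₁.support y≤₁x)) x≤y) y≤₁x
    ... | no  x∉B = let x≤₂y = glued-out-of-∁B (x∉p⇒x∈∁p x∉B) x≤y
                    in H₂.≤-antisym x≤₂y (glued-out-of-∁B (proj₂ (H₂.support x≤₂y)) y≤x)

    glued-trans : ∀ {x y z} → Glued M₁ M₂ x y → Glued M₁ M₂ y z → Glued M₁ M₂ x z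
    glued-trans {y = y} x≤y y≤z with y ∈? B
    ... | yes y∈B with glued-into-B y∈B x≤y | y≤z
    ...   | x≤₁y | inj₁ y≤₁z                     = inj₁ (H₁.≤-trans x≤₁y y≤₁z)
    ...   | x≤₁y | inj₂ (inj₁ y≤₂z)              = contradiction (proj₁ (H₂.support y≤₂z)) (x∈p⇒x∉∁p y∈B)
    ...   | x≤₁y | inj₂ (inj₂ (a , b , y≤a , r)) = inj₂ (inj₂ (a , b , H₁.≤-trans x≤₁y y≤a , r))
    glued-trans {y = y} x≤y y≤z | no y∉B with x≤y | glued-out-of-∁B (x∉p⇒x∈∁p y∉B) y≤z
    ...   | inj₁ x≤₁y                        | _    = contradiction (proj₂ (H₁.support x≤₁y)) y∉B
    ...   | inj₂ (inj₁ x≤₂y)                 | y≤₂z = inj₂ (inj₁ (H₂.≤-trans x≤₂y y≤₂z))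
    ...   | inj₂ (inj₂ (a , b , x≤a , a𝓡b , b≤y)) | y≤₂z =
      inj₂ (inj₂ (a , b , x≤a , a𝓡b , H₂.≤-trans b≤y y≤₂z))

    private
      B-≢-∁B : ∀ {x y} → x ∈ B → y ∈ ∁ B → x ≢ y
      B-≢-∁B x∈B y∈∁B refl = x∈p⇒x∉∁p x∈B y∈∁B

    glued-refl : ∀ x → Glued M₁ M₂ x x
    glued-refl x with x ∈? B
    ... | yes x∈B = inj₁ (H₁.≤-refl x∈B)
    ... | no  x∉B = inj₂ (inj₁ (H₂.≤-refl (x∉p⇒x∈∁p x∉B)))

    glue-cover⇒𝓡 : ∀ {x y} → Covers ⊤ (glue M₁ M₂) x y → x 𝓡 y
    glue-cover⇒𝓡 {x} {y} cover@(x≤y , x≢y , nothing-between) with glue⁻ M₁ M₂ x≤y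
    -- Covers ignores its subset argument, so covers-⊆ cannot infer it.
    ... | inj₁ x≤₁y        =
      H₁.cover⇒𝓡 (covers-⊆ {⊤} (glue M₁ M₂) M₁ (λ x≤y → glue⁺ M₁ M₂ (inj₁ x≤y)) x≤₁y cover)
    ... | inj₂ (inj₁ x≤₂y) =
      H₂.cover⇒𝓡 (covers-⊆ {⊤} (glue M₁ M₂) M₂ (λ x≤y → glue⁺ M₁ M₂ (inj₂ (inj₁ x≤y))) x≤₂y cover)
    ... | inj₂ (inj₂ bridge@(a , b , x≤a , a𝓡b , b≤y)) with x ≟ a | b ≟ y
    ...   | yes refl | yes refl = a𝓡b
    ...   | no x≢a   | _        =
      let a∈B = proj₂ (H₁.support x≤a)
      in contradiction (a , glue⁺ M₁ M₂ (inj₁ x≤a) , x≢a ,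
                        glue⁺ M₁ M₂ (inj₂ (inj₂ (a , b , H₁.≤-refl a∈B , a𝓡b , b≤y))) ,
                        B-≢-∁B a∈B (bridge-target bridge))
                       nothing-between
    ...   | yes _    | no b≢y   =
      let b∈∁B = proj₁ (H₂.support b≤y)
      in contradiction (b , glue⁺ M₁ M₂ (inj₂ (inj₂ (a , b , x≤a , a𝓡b , H₂.≤-refl b∈∁B))) ,
                        B-≢-∁B (bridge-source bridge) b∈∁B ,
                        glue⁺ M₁ M₂ (inj₂ (inj₁ b≤y)) , b≢y)
                       nothing-between

    module _ (𝓡-sym : ∀ x y → x 𝓡 y → y 𝓡 x) where

      glued-comparable : ∀ x y → x 𝓡 y → Glued M₁ M₂ x y ⊎ Glued M₁ M₂ y x
      glued-comparable x y x𝓡y with x ∈? B | y ∈? B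
      ... | yes x∈B | yes y∈B = Data.Sum.map inj₁ inj₁ (H₁.comparable x∈B y∈B x𝓡y)
      ... | no  x∉B | no  y∉B =
        Data.Sum.map (inj₂ ∘ inj₁) (inj₂ ∘ inj₁) (H₂.comparable (x∉p⇒x∈∁p x∉B) (x∉p⇒x∈∁p y∉B) x𝓡y)
      ... | yes x∈B | no  y∉B =
        inj₁ (inj₂ (inj₂ (x , y , H₁.≤-refl x∈B , x𝓡y , H₂.≤-refl (x∉p⇒x∈∁p y∉B))))
      ... | no  x∉B | yes y∈B =
        inj₂ (inj₂ (inj₂ (y , x , H₁.≤-refl y∈B , 𝓡-sym x y x𝓡y , H₂.≤-refl (x∉p⇒x∈∁p x∉B))))

      glue-isFullHeap : IsFullHeap ⊤ (glue M₁ M₂)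
      glue-isFullHeap =
        ((λ _ _ _ → ∈⊤ , ∈⊤) ,
         (λ x _ → glue⁺ M₁ M₂ (glued-refl x)) ,
         (λ _ _ x≤y y≤x → glued-antisym (glue⁻ M₁ M₂ x≤y) (glue⁻ M₁ M₂ y≤x)) ,
         (λ _ _ _ x≤y y≤z → glue⁺ M₁ M₂ (glued-trans (glue⁻ M₁ M₂ x≤y) (glue⁻ M₁ M₂ y≤z)))) ,
        (λ x y _ _ x𝓡y → Data.Sum.map (glue⁺ M₁ M₂) (glue⁺ M₁ M₂) (glued-comparable x y x𝓡y)) ,
        (λ _ _ → glue-cover⇒𝓡)

  -- Cutting a full heap along a down-closed set

  DownClosed : BRel n → Subset n → Set
  DownClosed M D = ∀ {x y} → x ≤[ M ] y → y ∈ D → x ∈ D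

  downClosed⇒convex : ∀ M {D} → DownClosed M D → Convex M D
  downClosed⇒convex M down-closed _ z∈D _ y≤z = down-closed y≤z z∈D

  downClosed⇒∁-convex : ∀ M {D} → DownClosed M D → Convex M (∁ D)
  downClosed⇒∁-convex M down-closed x∈∁D _ x≤y _ =
    x∉p⇒x∈∁p λ y∈D → x∈∁p⇒x∉p x∈∁D (down-closed x≤y y∈D)

  CrossingEdge : BRel n → Subset n → Fin n → Fin n → Set
  CrossingEdge M D x z = ∃₂ λ a b → x ≤[ M ] a × a ∈ D × a 𝓡 b × b ∉ D × b ≤[ M ] z

  crossing-edge : ∀ {A} M → IsFullHeap A M → ∀ {D} → DownClosed M D →
    ∀ {x z} → x ≤[ M ] z → x ∈ D → z ∉ D → CrossingEdge M D x z
  crossing-edge M heap {D} down-closed =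
    interval-induction (λ x z → x ∈ D → z ∉ D → CrossingEdge M D x z)
      (λ _ x∈D x∉D → contradiction x∈D x∉D)
      (λ cover x∈D z∉D →
         let (x∈A , z∈A) = support (proj₁ cover)
         in _ , _ , ≤-refl x∈A , x∈D , cover⇒𝓡 cover , z∉D , ≤-refl z∈A)
      compose
    where
      open FullHeap M heap
      compose : ∀ {x w z} → x ≤[ M ] w → w ≤[ M ] z →
        (x ∈ D → w ∉ D → CrossingEdge M D x w) → (w ∈ D → z ∉ D → CrossingEdge M D w z) →
        x ∈ D → z ∉ D → CrossingEdge M D x z
      compose {w = w} x≤w w≤z cross-xw cross-wz x∈D z∉D with w ∈? D
      ... | yes w∈D = let (a , b , w≤a , rest) = cross-wz w∈D z∉D in a , b , ≤-trans x≤w w≤a , rest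
      ... | no  w∉D = let (a , b , x≤a , a∈D , a𝓡b , b∉D , b≤w) = cross-xw x∈D w∉D
                      in a , b , x≤a , a∈D , a𝓡b , b∉D , ≤-trans b≤w w≤z

  downset : BRel n → Fin n → Subset n
  downset M β = subsetOf (_≤[ M ]? β)

  downset-downClosed : ∀ {A} M → IsPartialOrderOn A M → ∀ β → DownClosed M (downset M β)
  downset-downClosed M po β x≤y y∈D =
    ∈-subsetOf⁺ (_≤[ M ]? β) (≤-trans x≤y (∈-subsetOf⁻ (_≤[ M ]? β) y∈D))
    where open PartialOrderOn M po

  module Decomposition (𝓡-sym : ∀ x y → x 𝓡 y → y 𝓡 x)
                       {β₁ β₂ : Fin n} (β₁≢β₂ : β₁ ≢ β₂) (β₁𝓡β₂ : β₁ 𝓡 β₂) where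

    split : BRel n → Subset n × BRel n × BRel n
    split M = downset M β₁ , restrict M (downset M β₁) , restrict M (∁ (downset M β₁))

    IsSplitPyramid : Subset n × BRel n × BRel n → Set
    IsSplitPyramid (B₁ , M₁ , M₂) = IsFullPyramid B₁ M₁ β₁ × IsFullPyramid (∁ B₁) M₂ β₂

    module _ (M : BRel n) (pyramid : IsFullPyramid ⊤ M β₂) where
      private
        heap : IsFullHeap ⊤ M
        heap = proj₁ pyramid
        open FullHeap M heap
        D : Subset n
        D = downset M β₁
        D-downClosed : DownClosed M D
        D-downClosed = downset-downClosed M (proj₁ heap) β₁
        β₁∈D : β₁ ∈ D
        β₁∈D = ∈-subsetOf⁺ (_≤[ M ]? β₁) (≤-refl ∈⊤)
        β₂∈∁D : β₂ ∈ ∁ D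
        β₂∈∁D = x∉p⇒x∈∁p λ β₂∈D →
          β₁≢β₂ (proj₂ (proj₁ (proj₂ pyramid)) β₁ (∈-subsetOf⁻ (_≤[ M ]? β₁) β₂∈D))
        below-β₁ : ∀ {x} → x ∈ D → x ≤[ M ] β₁
        below-β₁ = ∈-subsetOf⁻ (_≤[ M ]? β₁)
        below-β₂ : ∀ {x} → x ∈ ∁ D → x ≤[ M ] β₂
        below-β₂ _ = below-top M pyramid ∈⊤

      split-admissible : Admissible β₁ β₂ D
      split-admissible =
        β₁∈D , β₂∈∁D ,
        convex-connected 𝓡-sym M heap (downClosed⇒convex M D-downClosed) β₁∈D below-β₁ ,
        convex-connected 𝓡-sym M heap (downClosed⇒∁-convex M D-downClosed) β₂∈∁D below-β₂

      split-isSplitPyramid : IsSplitPyramid (split M)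
      split-isSplitPyramid =
        restrict-isFullPyramid M heap (λ _ → ∈⊤) (downClosed⇒convex M D-downClosed) β₁∈D below-β₁ ,
        restrict-isFullPyramid M heap (λ _ → ∈⊤) (downClosed⇒∁-convex M D-downClosed) β₂∈∁D below-β₂

      glue-split : glue (restrict M D) (restrict M (∁ D)) ≡ M
      glue-split = BRel-ext (λ x≤y → glued⇒≤ (glue⁻ M₁ M₂ x≤y)) (λ x≤y → glue⁺ M₁ M₂ (≤⇒glued x≤y))
        where
          M₁ M₂ : BRel n
          M₁ = restrict M D
          M₂ = restrict M (∁ D)

          glued⇒≤ : ∀ {x y} → Glued M₁ M₂ x y → x ≤[ M ] y
          glued⇒≤ (inj₁ x≤y)        = proj₁ (restrict⁻ M D x≤y)
          glued⇒≤ (inj₂ (inj₁ x≤y)) = proj₁ (restrict⁻ M (∁ D) x≤y)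
          glued⇒≤ (inj₂ (inj₂ (a , b , x≤a , a𝓡b , b≤y)))
            with restrict⁻ M D x≤a | restrict⁻ M (∁ D) b≤y
          ... | x≤a , _ , a∈D | b≤y , b∈∁D , _ with comparable ∈⊤ ∈⊤ a𝓡b
          ...   | inj₁ a≤b = ≤-trans x≤a (≤-trans a≤b b≤y)
          ...   | inj₂ b≤a = contradiction (D-downClosed b≤a a∈D) (x∈∁p⇒x∉p b∈∁D)

          ≤⇒glued : ∀ {x y} → x ≤[ M ] y → Glued M₁ M₂ x y
          ≤⇒glued {x} {y} x≤y with x ∈? D | y ∈? D
          ... | yes x∈D | yes y∈D = inj₁ (restrict⁺ M D x≤y x∈D y∈D)
          ... | no  x∉D | no  y∉D = inj₂ (inj₁ (restrict⁺ M (∁ D) x≤y (x∉p⇒x∈∁p x∉D) (x∉p⇒x∈∁p y∉D)))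
          ... | no  x∉D | yes y∈D = contradiction (D-downClosed x≤y y∈D) x∉D
          ... | yes x∈D | no  y∉D =
            let (a , b , x≤a , a∈D , a𝓡b , b∉D , b≤y) = crossing-edge M heap D-downClosed x≤y x∈D y∉D
            in inj₂ (inj₂ (a , b , restrict⁺ M D x≤a x∈D a∈D , a𝓡b ,
                                   restrict⁺ M (∁ D) b≤y (x∉p⇒x∈∁p b∉D) (x∉p⇒x∈∁p y∉D)))

    module _ {B₁ : Subset n} (M₁ M₂ : BRel n)
             (pyramid₁ : IsFullPyramid B₁ M₁ β₁) (pyramid₂ : IsFullPyramid (∁ B₁) M₂ β₂) where
      private
        module H₁ = FullHeap M₁ (proj₁ pyramid₁)
        module H₂ = FullHeap M₂ (proj₁ pyramid₂)
        open GluedHeaps M₁ M₂ (proj₁ pyramid₁) (proj₁ pyramid₂)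
        G : BRel n
        G = glue M₁ M₂
        β₁∈B₁ : β₁ ∈ B₁
        β₁∈B₁ = proj₁ (proj₁ (proj₂ pyramid₁))
        β₂∈∁B₁ : β₂ ∈ ∁ B₁
        β₂∈∁B₁ = proj₁ (proj₁ (proj₂ pyramid₂))

      glue-isFullPyramid : IsFullPyramid ⊤ G β₂
      glue-isFullPyramid = greatest⇒isFullPyramid G (glue-isFullHeap 𝓡-sym) ∈⊤ below-β₂
        where
          below-β₂ : ∀ {x} → x ∈ ⊤ → x ≤[ G ] β₂
          below-β₂ {x} _ with x ∈? B₁
          ... | yes x∈B₁ = glue⁺ M₁ M₂ (inj₂ (inj₂
                  (β₁ , β₂ , below-top M₁ pyramid₁ x∈B₁ , β₁𝓡β₂ , H₂.≤-refl β₂∈∁B₁)))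
          ... | no  x∉B₁ = glue⁺ M₁ M₂ (inj₂ (inj₁ (below-top M₂ pyramid₂ (x∉p⇒x∈∁p x∉B₁))))

      split-glue : split G ≡ (B₁ , M₁ , M₂)
      split-glue = begin
        split G
          ≡⟨ cong (λ S → S , restrict G S , restrict G (∁ S)) downset-glue ⟩
        B₁ , restrict G B₁ , restrict G (∁ B₁)
          ≡⟨ cong₂ (λ M₁′ M₂′ → B₁ , M₁′ , M₂′) restrict-glue₁ restrict-glue₂ ⟩
        B₁ , M₁ , M₂ ∎
        where
          open ≡-Reasoning
          downset-glue : downset G β₁ ≡ B₁
          downset-glue = ⊆-antisym
            (λ x∈D → proj₁ (H₁.support (glued-into-B β₁∈B₁ (glue⁻ M₁ M₂ (∈-subsetOf⁻ (_≤[ G ]? β₁) x∈D)))))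
            (λ x∈B₁ → ∈-subsetOf⁺ (_≤[ G ]? β₁) (glue⁺ M₁ M₂ (inj₁ (below-top M₁ pyramid₁ x∈B₁))))
          restrict-glue₁ : restrict G B₁ ≡ M₁
          restrict-glue₁ = BRel-ext
            (λ x≤y → let (x≤y , _ , y∈B₁) = restrict⁻ G B₁ x≤y
                     in glued-into-B y∈B₁ (glue⁻ M₁ M₂ x≤y))
            (λ x≤y → let (x∈B₁ , y∈B₁) = H₁.support x≤y
                     in restrict⁺ G B₁ (glue⁺ M₁ M₂ (inj₁ x≤y)) x∈B₁ y∈B₁)
          restrict-glue₂ : restrict G (∁ B₁) ≡ M₂
          restrict-glue₂ = BRel-ext
            (λ x≤y → let (x≤y , x∈∁B₁ , _) = restrict⁻ G (∁ B₁) x≤y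
                     in glued-out-of-∁B x∈∁B₁ (glue⁻ M₁ M₂ x≤y))
            (λ x≤y → let (x∈∁B₁ , y∈∁B₁) = H₂.support x≤y
                     in restrict⁺ G (∁ B₁) (glue⁺ M₁ M₂ (inj₂ (inj₁ x≤y))) x∈∁B₁ y∈∁B₁)

    isSplitPyramid? : (t : Subset n × BRel n × BRel n) → Dec (IsSplitPyramid t)
    isSplitPyramid? (B₁ , M₁ , M₂) = isFullPyramid? B₁ M₁ β₁ ×-dec isFullPyramid? (∁ B₁) M₂ β₂

    candidates : List (Subset n × BRel n × BRel n)
    candidates = cartesianProduct (filter (admissible? β₁ β₂) (allSubsets n))
                                  (cartesianProduct (allBRels n) (allBRels n))

    #P≡count-splitPyramids : #P β₂ ⊤ ≡ count isSplitPyramid? candidates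
    #P≡count-splitPyramids =
      count-bijection (λ M → isFullPyramid? ⊤ M β₂) isSplitPyramid?
        (allBRels-unique n)
        (cartesianProduct⁺ (filter⁺ (admissible? β₁ β₂) (allSubsets-unique n))
                           (cartesianProduct⁺ (allBRels-unique n) (allBRels-unique n)))
        split (λ (_ , M₁ , M₂) → glue M₁ M₂)
        (λ {M} pyramid → ∈-cartesianProduct⁺
                           (∈-filter⁺ (admissible? β₁ β₂) (∈-allSubsets n _) (split-admissible M pyramid))
                           (∈-cartesianProduct⁺ (∈-allBRels n _) (∈-allBRels n _)) ,
                         split-isSplitPyramid M pyramid)
        (λ { {_ , M₁ , M₂} (pyramid₁ , pyramid₂) →
               ∈-allBRels n _ , glue-isFullPyramid M₁ M₂ pyramid₁ pyramid₂ })
        (λ {M} → glue-split M)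
        (λ { {_ , M₁ , M₂} (pyramid₁ , pyramid₂) → split-glue M₁ M₂ pyramid₁ pyramid₂ })

    count-splitPyramids≡partitionSum : count isSplitPyramid? candidates ≡ partitionSum β₁ β₂
    count-splitPyramids≡partitionSum =
      trans (count-cartesianProduct isSplitPyramid? (filter (admissible? β₁ β₂) (allSubsets n)) _)
            (cong sum (map-cong (λ B₁ → count-×-cartesianProduct (λ M₁ → isFullPyramid? B₁ M₁ β₁)
                                          (λ M₂ → isFullPyramid? (∁ B₁) M₂ β₂) (allBRels n) (allBRels n))
                                (filter (admissible? β₁ β₂) (allSubsets n))))

lemma2p14 : (n : ℕ) (R : Fin n → Fin n → Bool)
    → (∀ x → Pieces._𝓡_ R x x)
    → (∀ x y → Pieces._𝓡_ R x y → Pieces._𝓡_ R y x)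
    → Pieces.Connected R ⊤
    → (β₁ β₂ : Fin n) → β₁ ≢ β₂ → Pieces._𝓡_ R β₁ β₂
    → Pieces.#P R β₂ ⊤ ≡ Pieces.partitionSum R β₁ β₂
lemma2p14 n R _ 𝓡-sym _ β₁ β₂ β₁≢β₂ β₁𝓡β₂ =
  trans #P≡count-splitPyramids count-splitPyramids≡partitionSum
  where open Heaps.Decomposition R 𝓡-sym β₁≢β₂ β₁𝓡β₂
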